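{- Let $T$ be a spider and let $f$ be an independent broadcast on $T$ of maximum weight. If $f(v) > 0$, then $v$ is a leaf of $T$.
   Context: For a graph $G$, $d(u,v)$ is the distance, $\mathrm{ecc}(v)$ the eccentricity, $\mathrm{diam}(G)$ the diameter. A broadcast on $G$ is a function $f: V(G)\to\{0,\dots,\mathrm{diam}(G)\}$ with $f(v)\le\mathrm{ecc}(v)$; its weight is $\sum_v f(v)$. A vertex $v$ is broadcasting if $f(v)>0$; $u$ hears a broadcasting $v$ if $d(u,v)\le f(v)$. A broadcast is independent if every broadcasting vertex hears only itself. A spider $S(d_1,\dots,d_k)$ ($k\ge3$) is the tree obtained from $K_{1,k}$ by subdividing its edges: it has a branch vertex $u$ of degree $k$ and $k$ leaves, the $i$-th joined to $u$ by a path of length $d_i\ge1$, all other vertices having degree $2$. -}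

module Defs where

open import Data.Nat using (ℕ; zero; suc; _+_; _≤_; _<_)
open import Data.Fin using (Fin; toℕ)
open import Data.Product using (Σ; ∃; _×_; _,_)
open import Relation.Nullary using (¬_)
open import Relation.Binary.PropositionalEquality using (_≡_)

sumFin : (n : ℕ) → (Fin n → ℕ) → ℕ
sumFin zero    g = 0
sumFin (suc n) g = g Fin.zero + sumFin n (λ i → g (Fin.suc i))

-- The spider S(d_1,...,d_k): leg i has d i non-branch vertices.
-- Vertex  leg i j  (j : Fin (d i)) is at distance (toℕ j + 1) from the branch vertex.
module Spider (k : ℕ) (d : Fin k → ℕ) where

  data V : Set where
    centre : V
    leg    : (i : Fin k) → Fin (d i) → V

  data Adj : V → V → Set where
    c-l : ∀ {i} (j : Fin (d i)) → toℕ j ≡ 0 → Adj centre (leg i j)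
    l-c : ∀ {i} (j : Fin (d i)) → toℕ j ≡ 0 → Adj (leg i j) centre
    up  : ∀ {i} (j j′ : Fin (d i)) → toℕ j′ ≡ suc (toℕ j) → Adj (leg i j) (leg i j′)
    dn  : ∀ {i} (j j′ : Fin (d i)) → toℕ j′ ≡ suc (toℕ j) → Adj (leg i j′) (leg i j)

  data Walk : V → V → ℕ → Set where
    nil  : ∀ {v} → Walk v v 0
    cons : ∀ {u w v n} → Adj u w → Walk w v n → Walk u v (suc n)

  DistLe : V → V → ℕ → Set
  DistLe u v m = ∃ λ n → n ≤ m × Walk u v n

  DistGe : V → V → ℕ → Set
  DistGe u v m = ∀ n → Walk u v n → m ≤ n

  LeEcc : ℕ → V → Set
  LeEcc m v = ∃ λ u → DistGe v u m

  LeDiam : ℕ → Set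
  LeDiam m = ∃ λ u → ∃ λ w → DistGe u w m

  IsBroadcast : (V → ℕ) → Set
  IsBroadcast f = ∀ v → LeDiam (f v) × LeEcc (f v) v

  weight : (V → ℕ) → ℕ
  weight f = f centre + sumFin k (λ i → sumFin (d i) (λ j → f (leg i j)))

  Hears : (V → ℕ) → V → V → Set
  Hears f u v = 0 < f v × DistLe u v (f v)

  IsIndependent : (V → ℕ) → Set
  IsIndependent f = ∀ v w → 0 < f v → Hears f v w → w ≡ v

  IsIndepBroadcast : (V → ℕ) → Set
  IsIndepBroadcast f = IsBroadcast f × IsIndependent f

  IsMaxIndepBroadcast : (V → ℕ) → Set
  IsMaxIndepBroadcast f =
    IsIndepBroadcast f × (∀ g → IsIndepBroadcast g → weight g ≤ weight f)

  IsLeaf : V → Set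
  IsLeaf v = ∃ λ u → Adj v u × (∀ w → Adj v w → w ≡ u)

module Submission where

-- Silencing a broadcasting vertex v and letting another vertex L broadcast with strength R
-- gives an independent broadcast again, provided R does not exceed the eccentricity of L and
-- every other broadcaster lies beyond L's new range and cannot reach L; for a maximum
-- broadcast this forces R ≤ f L + f v. Every broadcasting non-leaf admits such a transfer
-- with R > f L + f v: an interior vertex towards a leaf (legs are treated from the outside
-- in, so the vertices beyond it are already known to be silent), and the centre towards
-- the leaf of a leg other than the one realising its eccentricity.

open import Defs
open import Data.Nat using (ℕ; zero; suc; _+_; _∸_; _≤_; _<_; z≤n; s≤s; ∣_-_∣; _≤?_; _<?_)
open import Data.Nat.Properties
open import Data.Nat.Tactic.RingSolver using (solve-∀)
open import Data.Fin using (Fin; toℕ; fromℕ<; punchIn)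
open import Data.Fin.Properties using (toℕ-injective; toℕ<n; toℕ-fromℕ<; punchInᵢ≢i; any?) renaming (_≟_ to _≟F_)
open import Data.Product using (∃; _×_; _,_; proj₁; proj₂)
open import Data.Empty using (⊥)
open import Data.Sum using (_⊎_; inj₁; inj₂)
open import Function using (_∘_)
open import Relation.Nullary using (¬_; Dec; yes; no; contradiction)
open import Relation.Nullary.Decidable using (_×-dec_; ¬?)
open import Relation.Binary.PropositionalEquality

sumFin-cong : ∀ n {g h : Fin n → ℕ} → (∀ q → g q ≡ h q) → sumFin n g ≡ sumFin n h
sumFin-cong zero    eq = refl
sumFin-cong (suc n) eq = cong₂ _+_ (eq Fin.zero) (sumFin-cong n (eq ∘ Fin.suc))

sumFin-update : ∀ n {g h : Fin n → ℕ} (p : Fin n) → (∀ q → q ≢ p → g q ≡ h q) →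
                sumFin n g + h p ≡ sumFin n h + g p
sumFin-update (suc n) {g} {h} Fin.zero agree
  rewrite sumFin-cong n (λ q → agree (Fin.suc q) λ ())
  = swap (g Fin.zero) (sumFin n (h ∘ Fin.suc)) (h Fin.zero)
  where
  swap : ∀ a b c → a + b + c ≡ c + b + a
  swap = solve-∀
sumFin-update (suc n) {g} {h} (Fin.suc p) agree = begin
  g Fin.zero + sumFin n (g ∘ Fin.suc) + h (Fin.suc p)    ≡⟨ +-assoc (g Fin.zero) _ _ ⟩
  g Fin.zero + (sumFin n (g ∘ Fin.suc) + h (Fin.suc p))  ≡⟨ cong₂ _+_ (agree Fin.zero λ ()) tail ⟩
  h Fin.zero + (sumFin n (h ∘ Fin.suc) + g (Fin.suc p))  ≡⟨ +-assoc (h Fin.zero) _ _ ⟨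
  h Fin.zero + sumFin n (h ∘ Fin.suc) + g (Fin.suc p)    ∎
  where
  open ≡-Reasoning
  tail = sumFin-update n p (λ q q≢p → agree (Fin.suc q) (q≢p ∘ Data.Fin.Properties.suc-injective))

+-exchange : ∀ {a b c d x y} → a + x ≡ b + y → y + c ≡ x + d → a + c ≡ b + d
+-exchange {a} {b} {c} {d} {x} {y} ax≡by yc≡xd = +-cancelʳ-≡ (x + y) (a + c) (b + d) (begin
  a + c + (x + y)   ≡⟨ shuffle a c x y ⟩
  a + x + (y + c)   ≡⟨ cong₂ _+_ ax≡by yc≡xd ⟩
  b + y + (x + d)   ≡⟨ shuffle′ b y x d ⟩
  b + d + (x + y)   ∎)
  where
  open ≡-Reasoning
  shuffle : ∀ a c x y → a + c + (x + y) ≡ a + x + (y + c)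
  shuffle = solve-∀
  shuffle′ : ∀ b y x d → b + y + (x + d) ≡ b + d + (x + y)
  shuffle′ = solve-∀

∣m-n∣≤1+∣1+m-n∣ : ∀ m n → ∣ m - n ∣ ≤ suc ∣ suc m - n ∣
∣m-n∣≤1+∣1+m-n∣ m n = begin
  ∣ m - n ∣                        ≤⟨ ∣-∣-triangle m (suc m) n ⟩
  ∣ m - suc m ∣ + ∣ suc m - n ∣    ≡⟨ cong (_+ ∣ suc m - n ∣) (trans (cong (∣_-_∣ m) (+-comm 1 m)) (∣m-m+n∣≡n m 1)) ⟩
  suc ∣ suc m - n ∣                ∎
  where open ≤-Reasoning

∣1+m-n∣≤1+∣m-n∣ : ∀ m n → ∣ suc m - n ∣ ≤ suc ∣ m - n ∣
∣1+m-n∣≤1+∣m-n∣ m n = begin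
  ∣ suc m - n ∣                    ≤⟨ ∣-∣-triangle (suc m) m n ⟩
  ∣ suc m - m ∣ + ∣ m - n ∣        ≡⟨ cong (_+ ∣ m - n ∣) (trans (∣-∣-comm (suc m) m) (trans (cong (∣_-_∣ m) (+-comm 1 m)) (∣m-m+n∣≡n m 1))) ⟩
  suc ∣ m - n ∣                    ∎
  where open ≤-Reasoning

module SpiderMetric (k : ℕ) (d : Fin k → ℕ) where
  open Spider k d

  dist : V → V → ℕ
  dist centre    centre      = 0
  dist centre    (leg i j)   = suc (toℕ j)
  dist (leg i j) centre      = suc (toℕ j)
  dist (leg i j) (leg i′ j′) with i ≟F i′
  ... | yes _ = ∣ toℕ j - toℕ j′ ∣
  ... | no  _ = suc (toℕ j) + suc (toℕ j′)

  dist-sameLeg : ∀ i (j j′ : Fin (d i)) → dist (leg i j) (leg i j′) ≡ ∣ toℕ j - toℕ j′ ∣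
  dist-sameLeg i j j′ with i ≟F i
  ... | yes _   = refl
  ... | no  i≢i = contradiction refl i≢i

  dist-otherLeg : ∀ {i i′} → i ≢ i′ → (j : Fin (d i)) (j′ : Fin (d i′)) →
                  dist (leg i j) (leg i′ j′) ≡ suc (toℕ j) + suc (toℕ j′)
  dist-otherLeg {i} {i′} i≢i′ j j′ with i ≟F i′
  ... | yes i≡i′ = contradiction i≡i′ i≢i′
  ... | no  _    = refl

  dist-sym : ∀ x y → dist x y ≡ dist y x
  dist-sym centre    centre      = refl
  dist-sym centre    (leg i j)   = refl
  dist-sym (leg i j) centre      = refl
  dist-sym (leg i j) (leg i′ j′) with i ≟F i′
  ... | yes refl = trans (∣-∣-comm (toℕ j) (toℕ j′)) (sym (dist-sameLeg i j′ j))
  ... | no  i≢i′ = trans (+-comm (suc (toℕ j)) (suc (toℕ j′))) (sym (dist-otherLeg (i≢i′ ∘ sym) j′ j))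

  dist-refl : ∀ x → dist x x ≡ 0
  dist-refl centre    = refl
  dist-refl (leg i j) = trans (dist-sameLeg i j j) (∣n-n∣≡0 (toℕ j))

  dist≡0⇒≡ : ∀ x y → dist x y ≡ 0 → x ≡ y
  dist≡0⇒≡ centre    centre      _ = refl
  dist≡0⇒≡ (leg i j) (leg i′ j′) dxy≡0 with i ≟F i′
  ... | yes refl = cong (leg i) (toℕ-injective (∣m-n∣≡0⇒m≡n dxy≡0))
  ... | no  _    with () ← dxy≡0

  0<dist : ∀ {x y} → x ≢ y → 0 < dist x y
  0<dist {x} {y} x≢y = n≢0⇒n>0 (x≢y ∘ dist≡0⇒≡ x y)

  Adj-sym : ∀ {x y} → Adj x y → Adj y x
  Adj-sym (c-l j j≡0)    = l-c j j≡0
  Adj-sym (l-c j j≡0)    = c-l j j≡0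
  Adj-sym (up j j′ j′≡1+j) = dn j j′ j′≡1+j
  Adj-sym (dn j j′ j′≡1+j) = up j j′ j′≡1+j

  _++ʷ_ : ∀ {x y z m n} → Walk x y m → Walk y z n → Walk x z (m + n)
  nil      ++ʷ q = q
  cons e p ++ʷ q = cons e (p ++ʷ q)

  reverseʷ : ∀ {x y n} → Walk x y n → Walk y x n
  reverseʷ nil                  = nil
  reverseʷ (cons {n = n} e p)   = subst (Walk _ _) (+-comm n 1) (reverseʷ p ++ʷ cons (Adj-sym e) nil)

  walk-outward : ∀ i n (j j′ : Fin (d i)) → toℕ j + n ≡ toℕ j′ → Walk (leg i j) (leg i j′) n
  walk-outward i zero    j j′ j+0≡j′ rewrite toℕ-injective (trans (sym (+-identityʳ (toℕ j))) j+0≡j′) = nil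
  walk-outward i (suc n) j j′ j+1+n≡j′ =
    cons (up j next (toℕ-fromℕ< 1+j<d)) (walk-outward i n next j′ (trans (cong (_+ n) (toℕ-fromℕ< 1+j<d)) j+1+n≡j′′))
    where
    j+1+n≡j′′ : suc (toℕ j) + n ≡ toℕ j′
    j+1+n≡j′′ = trans (sym (+-suc (toℕ j) n)) j+1+n≡j′
    1+j<d : suc (toℕ j) < d i
    1+j<d = ≤-<-trans (≤-trans (m≤m+n (suc (toℕ j)) n) (≤-reflexive j+1+n≡j′′)) (toℕ<n j′)
    next : Fin (d i)
    next = fromℕ< 1+j<d

  walk-sameLeg : ∀ i (j j′ : Fin (d i)) → Walk (leg i j) (leg i j′) ∣ toℕ j - toℕ j′ ∣
  walk-sameLeg i j j′ with ≤-total (toℕ j) (toℕ j′)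
  ... | inj₁ j≤j′ = subst (Walk _ _) (sym (m≤n⇒∣m-n∣≡n∸m j≤j′)) (walk-outward i _ j j′ (m+[n∸m]≡n j≤j′))
  ... | inj₂ j′≤j = subst (Walk _ _) (sym (m≤n⇒∣n-m∣≡n∸m j′≤j)) (reverseʷ (walk-outward i _ j′ j (m+[n∸m]≡n j′≤j)))

  walk-fromCentre : ∀ i (j : Fin (d i)) → Walk centre (leg i j) (suc (toℕ j))
  walk-fromCentre i j = cons (c-l first (toℕ-fromℕ< 0<d)) (walk-outward i (toℕ j) first j (cong (_+ toℕ j) (toℕ-fromℕ< 0<d)))
    where
    0<d : 0 < d i
    0<d = ≤-<-trans z≤n (toℕ<n j)
    first : Fin (d i)
    first = fromℕ< 0<d

  geodesic : ∀ x y → Walk x y (dist x y)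
  geodesic centre    centre      = nil
  geodesic centre    (leg i j)   = walk-fromCentre i j
  geodesic (leg i j) centre      = reverseʷ (walk-fromCentre i j)
  geodesic (leg i j) (leg i′ j′) with i ≟F i′
  ... | yes refl = walk-sameLeg i j j′
  ... | no  _    = reverseʷ (walk-fromCentre i j) ++ʷ walk-fromCentre i′ j′

  dist-Adj : ∀ {x y} → Adj x y → ∀ z → dist x z ≤ suc (dist y z)
  dist-Adj (c-l j j≡0) centre = z≤n
  dist-Adj (c-l {i} j j≡0) (leg i′ q) with i ≟F i′
  ... | yes refl rewrite j≡0 = ≤-refl
  ... | no  _    rewrite j≡0 = ≤-trans (n≤1+n _) (n≤1+n _)
  dist-Adj (l-c j j≡0) centre rewrite j≡0 = ≤-refl
  dist-Adj (l-c {i} j j≡0) (leg i′ q) with i ≟F i′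
  ... | yes refl rewrite j≡0 = ≤-trans (n≤1+n _) (n≤1+n _)
  ... | no  _    rewrite j≡0 = ≤-refl
  dist-Adj (up j j′ j′≡1+j) centre rewrite j′≡1+j = ≤-trans (n≤1+n _) (n≤1+n _)
  dist-Adj (up {i} j j′ j′≡1+j) (leg i′ q) with i ≟F i′
  ... | yes refl rewrite j′≡1+j = ∣m-n∣≤1+∣1+m-n∣ (toℕ j) (toℕ q)
  ... | no  _    rewrite j′≡1+j = ≤-trans (n≤1+n _) (n≤1+n _)
  dist-Adj (dn j j′ j′≡1+j) centre rewrite j′≡1+j = ≤-refl
  dist-Adj (dn {i} j j′ j′≡1+j) (leg i′ q) with i ≟F i′
  ... | yes refl rewrite j′≡1+j = ∣1+m-n∣≤1+∣m-n∣ (toℕ j) (toℕ q)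
  ... | no  _    rewrite j′≡1+j = ≤-refl

  dist≤length : ∀ {x y n} → Walk x y n → dist x y ≤ n
  dist≤length {x} nil                = ≤-reflexive (dist-refl x)
  dist≤length {y = y} (cons e p)     = ≤-trans (dist-Adj e y) (s≤s (dist≤length p))

  DistGe⇒≤dist : ∀ {x y m} → DistGe x y m → m ≤ dist x y
  DistGe⇒≤dist {x} {y} ge = ge _ (geodesic x y)

  ≤dist⇒DistGe : ∀ {x y m} → m ≤ dist x y → DistGe x y m
  ≤dist⇒DistGe m≤d n p = ≤-trans m≤d (dist≤length p)

  DistLe⇒dist≤ : ∀ {x y m} → DistLe x y m → dist x y ≤ m
  DistLe⇒dist≤ (n , n≤m , p) = ≤-trans (dist≤length p) n≤m

  dist≤⇒DistLe : ∀ {x y m} → dist x y ≤ m → DistLe x y m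
  dist≤⇒DistLe {x} {y} d≤m = _ , d≤m , geodesic x y

module Transfer (k : ℕ) (d : Fin k → ℕ) where
  open Spider k d
  open SpiderMetric k d

  _≟V_ : (x y : V) → Dec (x ≡ y)
  centre    ≟V centre      = yes refl
  centre    ≟V leg _ _     = no λ ()
  leg _ _   ≟V centre      = no λ ()
  leg i j   ≟V leg i′ j′ with i ≟F i′
  ... | no  i≢i′ = no λ { refl → i≢i′ refl }
  ... | yes refl with j ≟F j′
  ...   | yes refl = yes refl
  ...   | no  j≢j′ = no λ { refl → j≢j′ refl }

  update : (V → ℕ) → V → ℕ → V → ℕ
  update f p a x with x ≟V p
  ... | yes _ = a
  ... | no  _ = f x

  update-same : ∀ f p a → update f p a p ≡ a
  update-same f p a with p ≟V p
  ... | yes _   = refl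
  ... | no  p≢p = contradiction refl p≢p

  update-other : ∀ f p a {x} → x ≢ p → update f p a x ≡ f x
  update-other f p a {x} x≢p with x ≟V p
  ... | yes x≡p = contradiction x≡p x≢p
  ... | no  _   = refl

  weight-agree : ∀ {f g} p → (∀ x → x ≢ p → g x ≡ f x) → weight g + f p ≡ weight f + g p
  weight-agree {f} {g} centre agree =
    trans (cong (λ s → g centre + s + f centre) agree-on-legs)
          (swap (g centre) (sumFin k λ i → sumFin (d i) (f ∘ leg i)) (f centre))
    where
    agree-on-legs : sumFin k (λ i → sumFin (d i) (g ∘ leg i)) ≡ sumFin k (λ i → sumFin (d i) (f ∘ leg i))
    agree-on-legs = sumFin-cong k λ i → sumFin-cong (d i) λ j → agree (leg i j) λ ()
    swap : ∀ a b c → a + b + c ≡ c + b + a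
    swap = solve-∀
  weight-agree {f} {g} (leg i j) agree rewrite agree centre (λ ()) =
    trans (+-assoc (f centre) _ _) (trans (cong (f centre +_) legs) (sym (+-assoc (f centre) _ _)))
    where
    G F : Fin k → ℕ
    G i′ = sumFin (d i′) (g ∘ leg i′)
    F i′ = sumFin (d i′) (f ∘ leg i′)
    outer : sumFin k G + F i ≡ sumFin k F + G i
    outer = sumFin-update k i λ i′ i′≢i → sumFin-cong (d i′) λ j′ → agree (leg i′ j′) λ { refl → i′≢i refl }
    inner : G i + f (leg i j) ≡ F i + g (leg i j)
    inner = sumFin-update (d i) j λ j′ j′≢j → agree (leg i j′) λ { refl → j′≢j refl }
    legs : sumFin k G + f (leg i j) ≡ sumFin k F + g (leg i j)
    legs = +-exchange {a = sumFin k G} {b = sumFin k F} {x = F i} {y = G i} outer inner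

  weight-update : ∀ f p a → weight (update f p a) + f p ≡ weight f + a
  weight-update f p a =
    trans (weight-agree p λ x x≢p → update-other f p a x≢p) (cong (weight f +_) (update-same f p a))

  module _ {f : V → ℕ} {v L : V} (v≢L : v ≢ L) {R : ℕ} where

    transferred : V → ℕ
    transferred = update (update f v 0) L R

    data Role (x : V) : Set where
      is-L  : x ≡ L → Role x
      is-v  : x ≡ v → Role x
      other : x ≢ v → x ≢ L → Role x

    role : ∀ x → Role x
    role x with x ≟V L | x ≟V v
    ... | yes x≡L | _       = is-L x≡L
    ... | no  _   | yes x≡v = is-v x≡v
    ... | no  x≢L | no  x≢v = other x≢v x≢L

    transferred-L : transferred L ≡ R
    transferred-L = update-same _ L R

    transferred-v : transferred v ≡ 0
    transferred-v = trans (update-other _ L R v≢L) (update-same f v 0)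

    transferred-other : ∀ {x} → x ≢ v → x ≢ L → transferred x ≡ f x
    transferred-other x≢v x≢L = trans (update-other _ L R x≢L) (update-other f v 0 x≢v)

    transferred-weight : weight transferred + f L + f v ≡ weight f + R
    transferred-weight = begin
      weight transferred + f L + f v              ≡⟨ cong (λ z → weight transferred + z + f v) (update-other f v 0 (v≢L ∘ sym)) ⟨
      weight transferred + update f v 0 L + f v   ≡⟨ cong (_+ f v) (weight-update (update f v 0) L R) ⟩
      weight (update f v 0) + R + f v             ≡⟨ +-assoc (weight (update f v 0)) R (f v) ⟩
      weight (update f v 0) + (R + f v)           ≡⟨ cong (weight (update f v 0) +_) (+-comm R (f v)) ⟩
      weight (update f v 0) + (f v + R)           ≡⟨ +-assoc (weight (update f v 0)) (f v) R ⟨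
      weight (update f v 0) + f v + R             ≡⟨ cong (_+ R) (trans (weight-update f v 0) (+-identityʳ _)) ⟩
      weight f + R                                ∎
      where open ≡-Reasoning

    module _ (indep : IsIndepBroadcast f) {u : V} (R≤dLu : R ≤ dist L u)
             (apart : ∀ x → x ≢ v → x ≢ L → 0 < f x → R < dist L x × f x < dist L x) where

      transferred-broadcast : IsBroadcast transferred
      transferred-broadcast x with role x
      ... | is-L refl      = subst (λ r → LeDiam r × LeEcc r L) (sym transferred-L)
                                   ((L , u , ≤dist⇒DistGe R≤dLu) , (u , ≤dist⇒DistGe R≤dLu))
      ... | is-v refl      = subst (λ r → LeDiam r × LeEcc r v) (sym transferred-v)
                                   ((v , v , λ _ _ → z≤n) , (v , λ _ _ → z≤n))
      ... | other x≢v x≢L  = subst (λ r → LeDiam r × LeEcc r x) (sym (transferred-other x≢v x≢L)) (proj₁ indep x)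

      silent-v : ∀ {x} → 0 < transferred x → x ≢ v
      silent-v tx refl = <⇒≢ tx (sym transferred-v)

      transferred-independent : IsIndependent transferred
      transferred-independent x y tx (ty , x-hears-y) with role y | role x
      ... | is-v refl | _ = contradiction refl (silent-v ty)
      ... | _ | is-v refl = contradiction refl (silent-v tx)
      ... | is-L refl | is-L refl = refl
      ... | is-L refl | other x≢v x≢L =
        contradiction (subst (_≤ R) (dist-sym x L) (subst (dist x L ≤_) transferred-L (DistLe⇒dist≤ x-hears-y)))
                      (<⇒≱ (proj₁ (apart x x≢v x≢L (subst (0 <_) (transferred-other x≢v x≢L) tx))))
      ... | other y≢v y≢L | is-L refl =
        contradiction (subst (dist L y ≤_) (transferred-other y≢v y≢L) (DistLe⇒dist≤ x-hears-y))
                      (<⇒≱ (proj₂ (apart y y≢v y≢L (subst (0 <_) (transferred-other y≢v y≢L) ty))))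
      ... | other y≢v y≢L | other x≢v x≢L =
        proj₂ indep x y (subst (0 <_) (transferred-other x≢v x≢L) tx)
          (subst (0 <_) (transferred-other y≢v y≢L) ty ,
           dist≤⇒DistLe (subst (dist x y ≤_) (transferred-other y≢v y≢L) (DistLe⇒dist≤ x-hears-y)))

  transfer-bound : ∀ {f} → IsMaxIndepBroadcast f → ∀ {v L u R} → v ≢ L → R ≤ dist L u →
                   (∀ x → x ≢ v → x ≢ L → 0 < f x → R < dist L x × f x < dist L x) →
                   R ≤ f L + f v
  transfer-bound {f} (indep , maximum) {v} {L} {u} {R} v≢L R≤dLu apart = +-cancelˡ-≤ (weight f) R (f L + f v) (begin
    weight f + R                     ≡⟨ transferred-weight v≢L ⟨
    weight g + f L + f v             ≡⟨ +-assoc (weight g) (f L) (f v) ⟩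
    weight g + (f L + f v)           ≤⟨ +-monoˡ-≤ (f L + f v) (maximum g (transferred-broadcast v≢L indep R≤dLu apart , transferred-independent v≢L indep R≤dLu apart)) ⟩
    weight f + (f L + f v)           ∎)
    where
    open ≤-Reasoning
    g = transferred v≢L {R}

another-index : ∀ {k} → 2 ≤ k → (i : Fin k) → ∃ λ j → j ≢ i
another-index (s≤s (s≤s _)) i = punchIn i Fin.zero , punchInᵢ≢i i Fin.zero


module Leaves (k : ℕ) (d : Fin k → ℕ) (d≥1 : ∀ i → 1 ≤ d i) where
  open Spider k d
  open SpiderMetric k d

  lastIndex : ∀ i → Fin (d i)
  lastIndex i = fromℕ< (≤-reflexive (m+[n∸m]≡n (d≥1 i)))

  1+lastIndex : ∀ i → suc (toℕ (lastIndex i)) ≡ d i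
  1+lastIndex i = trans (cong suc (toℕ-fromℕ< _)) (m+[n∸m]≡n (d≥1 i))

  leaf : Fin k → V
  leaf i = leg i (lastIndex i)

  leg-injective : ∀ {i} {j j′ : Fin (d i)} → leg i j ≡ leg i j′ → j ≡ j′
  leg-injective refl = refl

  leg-≢ : ∀ {i i′} {j : Fin (d i)} {j′ : Fin (d i′)} → i ≢ i′ → leg i j ≢ leg i′ j′
  leg-≢ i≢i′ refl = i≢i′ refl

  interior⊎leaf : ∀ i (q : Fin (d i)) → suc (toℕ q) < d i ⊎ leg i q ≡ leaf i
  interior⊎leaf i q with suc (toℕ q) <? d i
  ... | yes interior = inj₁ interior
  ... | no  outermost = inj₂ (cong (leg i) (toℕ-injective (suc-injective
          (trans (≤-antisym (toℕ<n q) (≮⇒≥ outermost)) (sym (1+lastIndex i))))))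

  dist-leaf : ∀ {i i′} → i ≢ i′ → (q : Fin (d i′)) → dist (leaf i) (leg i′ q) ≡ d i + suc (toℕ q)
  dist-leaf {i} i≢i′ q = trans (dist-otherLeg i≢i′ (lastIndex i) q) (cong (_+ suc (toℕ q)) (1+lastIndex i))

  outermost-isLeaf : ∀ i (j : Fin (d i)) → suc (toℕ j) ≡ d i → IsLeaf (leg i j)
  outermost-isLeaf i j 1+j≡d with toℕ j in j≡
  ... | zero  = centre , l-c j j≡ , unique
    where
    unique : ∀ w → Adj (leg i j) w → w ≡ centre
    unique _ (l-c _ _)          = refl
    unique _ (up _ j′ j′≡1+j)   = contradiction (trans j′≡1+j (trans (cong suc j≡) 1+j≡d)) (<⇒≢ (toℕ<n j′))
    unique _ (dn _ _ j≡1+j₀)    with () ← trans (sym j≡) j≡1+j₀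
  ... | suc m = leg i inner , dn inner j j≡1+inner , unique
    where
    inner : Fin (d i)
    inner = fromℕ< (≤-trans (n≤1+n (suc m)) (≤-reflexive 1+j≡d))
    j≡1+inner : toℕ j ≡ suc (toℕ inner)
    j≡1+inner = trans j≡ (cong suc (sym (toℕ-fromℕ< _)))
    unique : ∀ w → Adj (leg i j) w → w ≡ leg i inner
    unique _ (l-c _ j≡0)        with () ← trans (sym j≡) j≡0
    unique _ (up _ j′ j′≡1+j)   = contradiction (trans j′≡1+j (trans (cong suc j≡) 1+j≡d)) (<⇒≢ (toℕ<n j′))
    unique _ (dn j₀ _ j≡1+j₀)   = cong (leg i) (toℕ-injective (suc-injective (trans (sym j≡1+j₀) j≡1+inner)))

  leaf-isLeaf : ∀ i → IsLeaf (leaf i)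
  leaf-isLeaf i = outermost-isLeaf i (lastIndex i) (1+lastIndex i)

module MaximumBroadcast (k : ℕ) (k≥3 : 3 ≤ k) (d : Fin k → ℕ) (d≥1 : ∀ i → 1 ≤ d i)
                        (f : Spider.V k d → ℕ) (maximum : Spider.IsMaxIndepBroadcast k d f) where
  open Spider k d
  open SpiderMetric k d
  open Transfer k d
  open Leaves k d d≥1

  indep : IsIndepBroadcast f
  indep = proj₁ maximum

  another : (i : Fin k) → ∃ λ j → j ≢ i
  another = another-index (≤-trans (n≤1+n 2) k≥3)

  hears⇒≡ : ∀ {x y} → 0 < f x → 0 < f y → dist x y ≤ f y → y ≡ x
  hears⇒≡ {x} {y} fx fy dxy≤fy = proj₂ indep x y fx (fy , dist≤⇒DistLe dxy≤fy)

  f<dist : ∀ {x y} → 0 < f x → y ≢ x → f y < dist x y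
  f<dist {x} {y} fx y≢x with dist x y ≤? f y
  ... | no  dxy≰fy = ≰⇒> dxy≰fy
  ... | yes dxy≤fy = contradiction (hears⇒≡ fx (<-≤-trans (0<dist (y≢x ∘ sym)) dxy≤fy) dxy≤fy) y≢x

  -- With s = f v and e = d(v, leaf i): if some other leg ends at distance ≥ s from v, v's
  -- broadcast moves to leaf i with strength e + s; otherwise v's range covers everything
  -- behind it, so s ≤ e, and it moves to the leaf of another leg.
  module OutermostInterior (i : Fin k) (j : Fin (d i)) (interior : suc (toℕ j) < d i)
      (beyond-silent : ∀ q → toℕ j < toℕ q → suc (toℕ q) < d i → ¬ 0 < f (leg i q)) where

    v = leg i j
    a = toℕ j
    e = toℕ (lastIndex i) ∸ a

    a<last : a < toℕ (lastIndex i)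
    a<last = ≤-pred (≤-trans interior (≤-reflexive (sym (1+lastIndex i))))

    a+e≡last : a + e ≡ toℕ (lastIndex i)
    a+e≡last = m+[n∸m]≡n (<⇒≤ a<last)

    d≡1+a+e : d i ≡ suc (a + e)
    d≡1+a+e = trans (sym (1+lastIndex i)) (cong suc (sym a+e≡last))

    dist-v-leaf : dist v (leaf i) ≡ e
    dist-v-leaf = trans (dist-sameLeg i j (lastIndex i)) (m≤n⇒∣m-n∣≡n∸m (<⇒≤ a<last))

    dist-leaf-v : dist (leaf i) v ≡ e
    dist-leaf-v = trans (dist-sym (leaf i) v) dist-v-leaf

    v≢leaf : v ≢ leaf i
    v≢leaf v≡leaf = <⇒≢ a<last (cong toℕ (leg-injective v≡leaf))

    d-split : ∀ n → d i + n ≡ e + (suc a + n)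
    d-split n = trans (cong (_+ n) d≡1+a+e) (rearrange a e n)
      where
      rearrange : ∀ a e n → suc (a + e) + n ≡ e + (suc a + n)
      rearrange = solve-∀

    dist-leaf-otherLeaf : ∀ {i′} → i′ ≢ i → dist (leaf i) (leaf i′) ≡ e + (suc a + d i′)
    dist-leaf-otherLeaf {i′} i′≢i = begin
      dist (leaf i) (leaf i′)                ≡⟨ dist-leaf (i′≢i ∘ sym) (lastIndex i′) ⟩
      d i + suc (toℕ (lastIndex i′))         ≡⟨ d-split _ ⟩
      e + (suc a + suc (toℕ (lastIndex i′))) ≡⟨ cong (λ n → e + (suc a + n)) (1+lastIndex i′) ⟩
      e + (suc a + d i′)                     ∎
      where open ≡-Reasoning

    -- The geodesic from the leaf of leg i to x passes through v, and x is no further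
    -- from v than the end of some other leg.
    Behind : V → Set
    Behind x = dist (leaf i) x ≡ e + dist v x × ∃ λ i′ → i′ ≢ i × dist v x ≤ suc a + d i′

    behind-centre : Behind centre
    behind-centre = trans (1+lastIndex i) (trans (sym (+-identityʳ (d i))) (trans (d-split 0) (cong (e +_) (+-identityʳ (suc a)))))
                  , proj₁ (another i) , proj₂ (another i) , m≤m+n (suc a) _

    behind-otherLeg : ∀ {i′} → i′ ≢ i → (q : Fin (d i′)) → Behind (leg i′ q)
    behind-otherLeg {i′} i′≢i q
      = trans (dist-leaf (i′≢i ∘ sym) q) (trans (d-split _) (cong (e +_) (sym dist-v-q)))
      , i′ , i′≢i , ≤-trans (≤-reflexive dist-v-q) (+-monoʳ-≤ (suc a) (toℕ<n q))
      where
      dist-v-q : dist v (leg i′ q) ≡ suc a + suc (toℕ q)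
      dist-v-q = dist-otherLeg (i′≢i ∘ sym) j q

    behind-inner : ∀ (q : Fin (d i)) → toℕ q < a → Behind (leg i q)
    behind-inner q q<a = dist-leaf-q , proj₁ (another i) , proj₂ (another i)
                       , ≤-trans (≤-reflexive dist-v-q) (≤-trans (m∸n≤m a (toℕ q)) (≤-trans (n≤1+n a) (m≤m+n (suc a) _)))
      where
      open ≡-Reasoning
      q≤a = <⇒≤ q<a
      dist-v-q : dist v (leg i q) ≡ a ∸ toℕ q
      dist-v-q = trans (dist-sameLeg i j q) (m≤n⇒∣n-m∣≡n∸m q≤a)
      dist-leaf-q : dist (leaf i) (leg i q) ≡ e + dist v (leg i q)
      dist-leaf-q = begin
        dist (leaf i) (leg i q)          ≡⟨ dist-sameLeg i (lastIndex i) q ⟩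
        ∣ toℕ (lastIndex i) - toℕ q ∣    ≡⟨ m≤n⇒∣n-m∣≡n∸m (≤-trans q≤a (<⇒≤ a<last)) ⟩
        toℕ (lastIndex i) ∸ toℕ q        ≡⟨ cong (_∸ toℕ q) a+e≡last ⟨
        a + e ∸ toℕ q                    ≡⟨ +-∸-comm e q≤a ⟩
        a ∸ toℕ q + e                    ≡⟨ +-comm _ e ⟩
        e + (a ∸ toℕ q)                  ≡⟨ cong (e +_) dist-v-q ⟨
        e + dist v (leg i q)             ∎

    ahead⊎behind : ∀ x → (∃ λ q → x ≡ leg i q × a ≤ toℕ q) ⊎ Behind x
    ahead⊎behind centre = inj₂ behind-centre
    ahead⊎behind (leg i′ q) with i′ ≟F i
    ... | no  i′≢i = inj₂ (behind-otherLeg i′≢i q)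
    ... | yes refl with a ≤? toℕ q
    ...   | yes a≤q = inj₁ (q , refl , a≤q)
    ...   | no  a≰q = inj₂ (behind-inner q (≰⇒> a≰q))

    dist-v-ahead : ∀ q → a ≤ toℕ q → dist v (leg i q) ≤ e
    dist-v-ahead q a≤q = ≤-trans (≤-reflexive (trans (dist-sameLeg i j q) (m≤n⇒∣m-n∣≡n∸m a≤q)))
                                 (∸-monoˡ-≤ a (≤-pred (≤-trans (toℕ<n q) (≤-reflexive (sym (1+lastIndex i))))))

    leaf⊎behind : ∀ x → 0 < f x → x ≢ v → x ≡ leaf i ⊎ Behind x
    leaf⊎behind x fx x≢v with ahead⊎behind x
    ... | inj₂ behind = inj₂ behind
    ... | inj₁ (q , refl , a≤q) with interior⊎leaf i q
    ...   | inj₂ x≡leaf  = inj₁ x≡leaf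
    ...   | inj₁ interior′ = contradiction fx (beyond-silent q a<q interior′)
      where
      a<q : a < toℕ q
      a<q = ≤∧≢⇒< a≤q λ a≡q → x≢v (cong (leg i) (toℕ-injective (sym a≡q)))

    module _ (fv : 0 < f v) where

      leaf-short : f (leaf i) < e
      leaf-short = subst (f (leaf i) <_) dist-v-leaf (f<dist fv (v≢leaf ∘ sym))

      long-leg-absurd : ∀ {i′} → i′ ≢ i → f v ≤ suc a + d i′ → ⊥
      long-leg-absurd {i′} i′≢i s≤ = <⇒≱ gain (transfer-bound maximum v≢leaf range apart)
        where
        R = e + f v
        range : R ≤ dist (leaf i) (leaf i′)
        range = ≤-trans (+-monoʳ-≤ e s≤) (≤-reflexive (sym (dist-leaf-otherLeaf i′≢i)))
        apart : ∀ x → x ≢ v → x ≢ leaf i → 0 < f x → R < dist (leaf i) x × f x < dist (leaf i) x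
        apart x x≢v x≢leaf fx with leaf⊎behind x fx x≢v
        ... | inj₁ x≡leaf = contradiction x≡leaf x≢leaf
        ... | inj₂ (via-v , _) rewrite via-v
          = +-monoʳ-< e (subst (f v <_) (dist-sym x v) (f<dist fx (x≢v ∘ sym)))
          , ≤-trans (f<dist fv x≢v) (m≤n+m _ e)
        gain : f (leaf i) + f v < R
        gain = +-monoˡ-< (f v) leaf-short

      short-legs-absurd : (∀ i′ → i′ ≢ i → suc a + d i′ < f v) → ⊥
      short-legs-absurd short = <⇒≱ gain (transfer-bound maximum v≢L range apart)
        where
        i′ = proj₁ (another i)
        i′≢i = proj₂ (another i)
        L = leaf i′
        R = f v + (suc a + d i′)
        behind-heard : ∀ x → Behind x → dist v x < f v
        behind-heard _ (_ , i″ , i″≢i , dvx≤) = ≤-<-trans dvx≤ (short i″ i″≢i)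
        only-leaf : ∀ x → 0 < f x → x ≢ v → x ≡ leaf i
        only-leaf x fx x≢v with leaf⊎behind x fx x≢v
        ... | inj₁ x≡leaf = x≡leaf
        ... | inj₂ behind = contradiction
          (hears⇒≡ fx fv (subst (_≤ f v) (dist-sym v x) (<⇒≤ (behind-heard x behind)))) (x≢v ∘ sym)
        s≤e : f v ≤ e
        s≤e with proj₂ (proj₁ indep v)
        ... | u , ge with ahead⊎behind u
        ...   | inj₁ (q , refl , a≤q) = ≤-trans (DistGe⇒≤dist ge) (dist-v-ahead q a≤q)
        ...   | inj₂ behind = contradiction (DistGe⇒≤dist ge) (<⇒≱ (behind-heard u behind))
        v≢L : v ≢ L
        v≢L = leg-≢ (i′≢i ∘ sym)
        dist-L-leaf : dist L (leaf i) ≡ e + (suc a + d i′)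
        dist-L-leaf = trans (dist-sym L (leaf i)) (dist-leaf-otherLeaf i′≢i)
        range : R ≤ dist L (leaf i)
        range = subst (R ≤_) (sym dist-L-leaf) (+-monoˡ-≤ _ s≤e)
        apart : ∀ x → x ≢ v → x ≢ L → 0 < f x → R < dist L x × f x < dist L x
        apart x x≢v x≢L fx with only-leaf x fx x≢v
        ... | refl rewrite dist-L-leaf
          = +-monoˡ-< _ (subst (f v <_) dist-leaf-v (f<dist fx v≢leaf))
          , ≤-trans leaf-short (m≤m+n e _)
        L-silent : f L ≡ 0
        L-silent = n≤0⇒n≡0 (≮⇒≥ λ fL → leg-≢ i′≢i (only-leaf L fL (v≢L ∘ sym)))
        gain : f L + f v < R
        gain rewrite L-silent = m<m+n (f v) (s≤s z≤n)

    v-silent : ¬ 0 < f v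
    v-silent fv with any? (λ i′ → ¬? (i′ ≟F i) ×-dec (f v ≤? suc a + d i′))
    ... | yes (i′ , i′≢i , s≤) = long-leg-absurd fv i′≢i s≤
    ... | no  none = short-legs-absurd fv λ i′ i′≢i → ≰⇒> λ s≤ → none (i′ , i′≢i , s≤)

  interior-silent : ∀ i (j : Fin (d i)) → suc (toℕ j) < d i → ¬ 0 < f (leg i j)
  interior-silent i j = go (d i) j (m≤m+n (d i) (toℕ j))
    where
    -- induction on n, which bounds the number of vertices beyond j on leg i
    go : ∀ n (j : Fin (d i)) → d i ≤ n + toℕ j → suc (toℕ j) < d i → ¬ 0 < f (leg i j)
    go zero    j d≤j _ = contradiction (toℕ<n j) (≤⇒≯ d≤j)
    go (suc n) j d≤n+1+j interior = OutermostInterior.v-silent i j interior λ q j<q →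
      go n q (≤-trans d≤n+1+j (≤-trans (≤-reflexive (sym (+-suc n (toℕ j)))) (+-monoʳ-≤ n j<q)))

  -- The centre's broadcast, of strength s ≤ d(centre, u) with u on leg i,
  -- is moved to the leaf of another leg with strength s + (length of that leg).
  centre-silent : ¬ 0 < f centre
  centre-silent fc with proj₂ (proj₁ indep centre)
  ... | centre  , ge = <⇒≱ fc (DistGe⇒≤dist ge)
  ... | leg i q , ge = <⇒≱ gain (transfer-bound maximum (λ ()) range apart)
    where
    j = proj₁ (another i)
    j≢i = proj₂ (another i)
    L = leaf j
    R = f centre + d j
    range : R ≤ dist L (leg i q)
    range = subst (R ≤_) (sym (trans (dist-leaf j≢i q) (+-comm (d j) _))) (+-monoˡ-≤ (d j) (DistGe⇒≤dist ge))
    apart : ∀ x → x ≢ centre → x ≢ L → 0 < f x → R < dist L x × f x < dist L x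
    apart centre     x≢c _ _ = contradiction refl x≢c
    apart (leg i′ q′) _ x≢L fx with i′ ≟F j
    ... | no i′≢j rewrite dist-leaf (i′≢j ∘ sym) q′
      = subst (R <_) (+-comm (suc (toℕ q′)) (d j)) (+-monoˡ-< (d j) (f<dist fx λ ()))
      , ≤-trans (f<dist fc λ ()) (m≤n+m _ (d j))
    ... | yes refl with interior⊎leaf j q′
    ...   | inj₁ interior = contradiction fx (interior-silent j q′ interior)
    ...   | inj₂ x≡L     = contradiction x≡L x≢L
    gain : f L + f centre < R
    gain = subst (_< R) (+-comm (f centre) (f L))
                 (+-monoʳ-< (f centre) (subst (f L <_) (1+lastIndex j) (f<dist fc λ ())))

  broadcaster-isLeaf : ∀ x → 0 < f x → IsLeaf x
  broadcaster-isLeaf centre    fx = contradiction fx centre-silent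
  broadcaster-isLeaf (leg i j) fx with interior⊎leaf i j
  ... | inj₁ interior = contradiction fx (interior-silent i j interior)
  ... | inj₂ refl     = leaf-isLeaf i

mainTheorem17 : (k : ℕ) → 3 ≤ k → (d : Fin k → ℕ) → (∀ i → 1 ≤ d i) →
                (f : Spider.V k d → ℕ) → Spider.IsMaxIndepBroadcast k d f →
                ∀ v → 0 < f v → Spider.IsLeaf k d v
mainTheorem17 k k≥3 d d≥1 f maximum = MaximumBroadcast.broadcaster-isLeaf k k≥3 d d≥1 f maximum
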